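{- For all formulas $A,B,C$ of $\mathcal{L}_{\vartriangleleft^2}$: (1) $\vDash (C\vartriangleleft^1 B)\to((C,A)\vartriangleleft^2 B)$; (2) $\vDash (C\vartriangleleft^1 A)\to\big(((C,A)\vartriangleleft^2 B)\leftrightarrow(C\vartriangleleft^1 B)\big)$.
   Context: Models are $\mathcal{M}=\langle W,S,V\rangle$ with $W$ nonempty, $S\subseteq W^3$ arbitrary (written $S_wuv$), $V$ a valuation. For each $n\in\mathbb{N}$, $\vartriangleleft^n$ is an $(n+1)$-ary operator with $\mathcal{M},w\vDash(A_1,\dots,A_n)\vartriangleleft^n B$ iff for all $u,v\in W$ with $S_wuv$, if ($\mathcal{M},u\vDash A_i\iff\mathcal{M},v\vDash A_i$) for all $i\in\{1,\dots,n\}$, then ($\mathcal{M},u\vDash B\iff\mathcal{M},v\vDash B$). $\mathcal{L}_{\vartriangleleft^n}$ extends propositional logic with $\vartriangleleft^n$ as sole modality; Boolean and atomic clauses as usual. $\vDash$ denotes truth at every world of every model. -}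

module Defs where

open import Data.Nat using (ℕ)
open import Data.Product using (_×_; _,_)
open import Data.Empty using (⊥)
open import Level using (Level; suc; _⊔_)

record Model (ℓ : Level) : Set (suc ℓ) where
  field
    W : Set ℓ
    w₀ : W
    S : W → W → W → Set ℓ
    V : W → ℕ → Set ℓ

infix 3 _⇔_
_⇔_ : {ℓ : Level} → Set ℓ → Set ℓ → Set ℓ
P ⇔ Q = (P → Q) × (Q → P)

-- Formulas of L_{◁²}: propositional logic with the ternary ◁² as sole modality.
-- (¬, ∧, ∨, ↔ are definable from ⊥ and →.)
infixr 4 _⇒_

data Fm : Set where
  atom : ℕ → Fm
  ⊥′   : Fm
  _⇒_  : Fm → Fm → Fm
  tri2 : Fm → Fm → Fm → Fm      -- tri2 A₁ A₂ B  =  (A₁ , A₂) ◁² B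

-- Formulas over L_{◁²} with ◁¹, ◁², →, ↔ as outer connectives
-- (needed to state the proposition, which mixes ◁¹ and ◁²).
infixr 4 _⇒⁺_
infix 3 _⇔⁺_

data Fm⁺ : Set where
  ⌜_⌝   : Fm → Fm⁺
  tri1⁺ : Fm⁺ → Fm⁺ → Fm⁺
  tri2⁺ : Fm⁺ → Fm⁺ → Fm⁺ → Fm⁺
  _⇒⁺_  : Fm⁺ → Fm⁺ → Fm⁺
  _⇔⁺_  : Fm⁺ → Fm⁺ → Fm⁺

module _ {ℓ : Level} (M : Model ℓ) where
  open Model M

  infix 5 _⊨_ _⊨⁺_
  _⊨_ : W → Fm → Set ℓ
  w ⊨ atom p = V w p
  w ⊨ ⊥′ = Level.Lift ℓ ⊥
  w ⊨ (A ⇒ B) = w ⊨ A → w ⊨ B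
  w ⊨ tri2 A₁ A₂ B = ∀ u v → S w u v →
    (u ⊨ A₁ ⇔ v ⊨ A₁) → (u ⊨ A₂ ⇔ v ⊨ A₂) → (u ⊨ B ⇔ v ⊨ B)

  _⊨⁺_ : W → Fm⁺ → Set ℓ
  w ⊨⁺ ⌜ A ⌝ = w ⊨ A
  w ⊨⁺ tri1⁺ A₁ B = ∀ u v → S w u v →
    (u ⊨⁺ A₁ ⇔ v ⊨⁺ A₁) → (u ⊨⁺ B ⇔ v ⊨⁺ B)
  w ⊨⁺ tri2⁺ A₁ A₂ B = ∀ u v → S w u v →
    (u ⊨⁺ A₁ ⇔ v ⊨⁺ A₁) → (u ⊨⁺ A₂ ⇔ v ⊨⁺ A₂) → (u ⊨⁺ B ⇔ v ⊨⁺ B)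
  w ⊨⁺ (A ⇒⁺ B) = w ⊨⁺ A → w ⊨⁺ B
  w ⊨⁺ (A ⇔⁺ B) = w ⊨⁺ A ⇔ w ⊨⁺ B

Valid : (ℓ : Level) → Fm⁺ → Set (suc ℓ)
Valid ℓ φ = (M : Model ℓ) (w : Model.W M) → _⊨⁺_ M w φ

module Submission where

-- The proof is entirely pointwise, at a fixed world of a fixed model:
--
--   * weakening: adding a further agreement premise can only help, so
--     C ◁¹ B implies (C, A) ◁² B;
--   * redundant premise: if C ◁¹ A holds, agreement on C already yields
--     agreement on A, so (C, A) ◁² B implies C ◁¹ B.

open import Defs
open import Data.Product using (_×_; _,_)
open import Level using (Level)

module _ {ℓ : Level} (M : Model ℓ) (w : Model.W M) where

  tri1⇒tri2 : (C A B : Fm⁺) →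
    _⊨⁺_ M w (tri1⁺ C B) → _⊨⁺_ M w (tri2⁺ C A B)
  tri1⇒tri2 C A B C◁B u v Swuv agreeC _ = C◁B u v Swuv agreeC

  tri2⇒tri1 : (C A B : Fm⁺) → _⊨⁺_ M w (tri1⁺ C A) →
    _⊨⁺_ M w (tri2⁺ C A B) → _⊨⁺_ M w (tri1⁺ C B)
  tri2⇒tri1 C A B C◁A CA◁B u v Swuv agreeC =
    CA◁B u v Swuv agreeC (C◁A u v Swuv agreeC)

proposition6p1 : ∀ {ℓ : Level} (A B C : Fm) →
    Valid ℓ (tri1⁺ ⌜ C ⌝ ⌜ B ⌝ ⇒⁺ tri2⁺ ⌜ C ⌝ ⌜ A ⌝ ⌜ B ⌝)
    × Valid ℓ (tri1⁺ ⌜ C ⌝ ⌜ A ⌝ ⇒⁺ (tri2⁺ ⌜ C ⌝ ⌜ A ⌝ ⌜ B ⌝ ⇔⁺ tri1⁺ ⌜ C ⌝ ⌜ B ⌝))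
proposition6p1 A B C = part1 , part2
  where
  part1 : Valid _ (tri1⁺ ⌜ C ⌝ ⌜ B ⌝ ⇒⁺ tri2⁺ ⌜ C ⌝ ⌜ A ⌝ ⌜ B ⌝)
  part1 M w = tri1⇒tri2 M w ⌜ C ⌝ ⌜ A ⌝ ⌜ B ⌝

  part2 : Valid _ (tri1⁺ ⌜ C ⌝ ⌜ A ⌝ ⇒⁺ (tri2⁺ ⌜ C ⌝ ⌜ A ⌝ ⌜ B ⌝ ⇔⁺ tri1⁺ ⌜ C ⌝ ⌜ B ⌝))
  part2 M w C◁A =
    tri2⇒tri1 M w ⌜ C ⌝ ⌜ A ⌝ ⌜ B ⌝ C◁A , tri1⇒tri2 M w ⌜ C ⌝ ⌜ A ⌝ ⌜ B ⌝
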